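{- Let $\mathcal L$ be a nominal poset, $a$ an atom and $x\in\mathcal L$, and let $x\langle a\rangle=\{x\}\cup\{(b\ a)\cdot x\mid b\#x\}$. (1) If $\bigwedge^{\#a}x$ exists then so does the greatest lower bound $\bigwedge x\langle a\rangle$, and they are equal. (2) If $\mathcal L$ is moreover a $\sigma$-algebra over a termlike $\sigma$-algebra with monotone $\sigma$-action, and $\bigwedge x\langle a\rangle$ exists, then $\bigwedge^{\#a}x$ exists and they are equal.
   Context: Atoms $\mathbb A$ (countably infinite; $a,b,c$ distinct), permutations, swappings $(a\ b)$, nominal sets, support $\mathrm{supp}$, $a\#x$ ($a\notin\mathrm{supp}(x)$), equivariance as standard. A nominal poset is a nominal set with an equivariant partial order. $\bigwedge^{\#a}x$ denotes the greatest element of $\{x'\mid x'\le x,\ a\#x'\}$, if it exists. Termlike $\sigma$-algebra $\mathsf U$: nominal set with equivariant $x[a:=u]$ and equivariant injection $\mathrm{atm}:\mathbb A\to\mathsf U$ satisfying $a[a:=x]=x$; $x[a:=a]=x$; $a\#x\Rightarrow x[a:=u]=x$; $b\#x\Rightarrow x[a:=u]=((b\ a)\cdot x)[b:=u]$; $a\#v\Rightarrow x[a:=u][b:=v]=x[b:=v][a:=u[b:=v]]$; a $\sigma$-algebra over $\mathsf U$ is a nominal set with equivariant substitution by elements of $\mathsf U$ satisfying the last four axioms. Monotone: $x\le y$ implies $x[a:=u]\le y[a:=u]$. -}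

module Defs where

open import Data.Nat using (ℕ; _≟_)
open import Data.Product using (Σ; ∃; _×_; _,_)
open import Data.Sum using (_⊎_)
open import Data.List using (List; []; _∷_)
open import Data.List.Membership.Propositional using (_∈_; _∉_)
open import Relation.Nullary using (¬_; yes; no)
open import Relation.Binary.PropositionalEquality using (_≡_)
open import Relation.Binary.Structures using (IsPartialOrder)
open import Function using (Injective)

Atom : Set
Atom = ℕ

swapA : Atom → Atom → Atom → Atom
swapA a b c with c ≟ a
... | yes _ = b
... | no _ with c ≟ b
...   | yes _ = a
...   | no _ = c

-- Finite permutations of atoms, presented as finite composites of
-- swappings: (a₁ b₁) ∘ (a₂ b₂) ∘ ... ∘ (aₙ bₙ).
Perm : Set
Perm = List (Atom × Atom)

permA : Perm → Atom → Atom
permA [] c = c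
permA ((a , b) ∷ π) c = swapA a b (permA π c)

_≈ₚ_ : Perm → Perm → Set
π ≈ₚ π' = ∀ c → permA π c ≡ permA π' c

actWith : {C : Set} → (Atom → Atom → C → C) → Perm → C → C
actWith swp [] x = x
actWith swp ((a , b) ∷ π) x = swp a b (actWith swp π x)

SupportsWith : {C : Set} → (Atom → Atom → C → C) → List Atom → C → Set
SupportsWith swp S x =
  ∀ π → (∀ c → c ∈ S → permA π c ≡ c) → actWith swp π x ≡ x

record NominalSet : Set₁ where
  field
    Carrier : Set
    swp     : Atom → Atom → Carrier → Carrier
    -- the induced action depends only on the permutation denoted (so it
    -- is a genuine action of the group of finite permutations)
    act-ext  : ∀ π π' → π ≈ₚ π' → ∀ x → actWith swp π x ≡ actWith swp π' x
    finsupp  : ∀ x → ∃ λ S → SupportsWith swp S x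

  act : Perm → Carrier → Carrier
  act = actWith swp

  Supports : List Atom → Carrier → Set
  Supports = SupportsWith swp

  -- a # x  iff  a ∉ supp(x), where supp(x) is the intersection of all
  -- finite supporting sets of x.
  _#_ : Atom → Carrier → Set
  a # x = ∃ λ S → Supports S x × a ∉ S


record NominalPosetStr (X : NominalSet) : Set₁ where
  open NominalSet X
  field
    _≤_            : Carrier → Carrier → Set
    isPartialOrder : IsPartialOrder _≡_ _≤_
    ≤-equivariant  : ∀ π {x y} → x ≤ y → act π x ≤ act π y

record Termlike : Set₁ where
  field
    nomU : NominalSet
  open NominalSet nomU renaming (Carrier to U)
  field
    subU : U → Atom → U → U          -- x[a:=u]
    atm  : Atom → U
    subU-equivariant : ∀ π x a u →
      act π (subU x a u) ≡ subU (act π x) (permA π a) (act π u)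
    atm-equivariant  : ∀ π a → act π (atm a) ≡ atm (permA π a)
    atm-injective    : Injective _≡_ _≡_ atm
    var↦  : ∀ a x → subU (atm a) a x ≡ x
    id↦   : ∀ a x → subU x a (atm a) ≡ x
    #↦    : ∀ a x u → a # x → subU x a u ≡ x
    α     : ∀ a b x u → ¬ a ≡ b → b # x →
              subU x a u ≡ subU (act ((b , a) ∷ []) x) b u
    σσ    : ∀ a b x u v → ¬ a ≡ b → a # v →
              subU (subU x a u) b v ≡ subU (subU x b v) a (subU u b v)


record SigmaAlgebra (𝕌 : Termlike) (X : NominalSet) : Set₁ where
  open NominalSet X
  private
    UN = Termlike.nomU 𝕌
    U  = NominalSet.Carrier UN
    actU = NominalSet.act UN
    _#U_ = NominalSet._#_ UN
    _[_:=ᵤ_] : U → Atom → U → U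
    u [ b :=ᵤ v ] = Termlike.subU 𝕌 u b v
  field
    sub : Carrier → Atom → U → Carrier   -- x[a:=u]
    sub-equivariant : ∀ π x a u →
      act π (sub x a u) ≡ sub (act π x) (permA π a) (actU π u)
    id↦ : ∀ a x → sub x a (Termlike.atm 𝕌 a) ≡ x
    #↦  : ∀ a x u → a # x → sub x a u ≡ x
    α   : ∀ a b x u → ¬ a ≡ b → b # x →
            sub x a u ≡ sub (act ((b , a) ∷ []) x) b u
    σσ  : ∀ a b x u v → ¬ a ≡ b → a #U v →
            sub (sub x a u) b v ≡ sub (sub x b v) a (u [ b :=ᵤ v ])

Monotone : {𝕌 : Termlike} {X : NominalSet} →
           NominalPosetStr X → SigmaAlgebra 𝕌 X → Set
Monotone {𝕌} {X} P S =
  ∀ {x y} a u → x ≤ y → SigmaAlgebra.sub S x a u ≤ SigmaAlgebra.sub S y a u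
  where open NominalPosetStr P

module _ (X : NominalSet) (P : NominalPosetStr X) where
  open NominalSet X
  open NominalPosetStr P

  IsFreshMeet : Atom → Carrier → Carrier → Set
  IsFreshMeet a x m =
    m ≤ x × a # m × (∀ x' → x' ≤ x → a # x' → x' ≤ m)

  Orbit : Atom → Carrier → Carrier → Set
  Orbit a x y = y ≡ x ⊎ ∃ λ b → b # x × y ≡ act ((b , a) ∷ []) x

  IsGLB : (Carrier → Set) → Carrier → Set
  IsGLB A m = (∀ y → A y → m ≤ y) ×
              (∀ m' → (∀ y → A y → m' ≤ y) → m' ≤ m)

module Submission where

-- (1) Let m = ⋀^{#a} x.  Fresh meets are unique and equivariant, so every
--     permutation fixing a and a support of x fixes m; hence
--     supp(m) ⊆ supp(x) ∪ {a}, and every b # x is also fresh for m.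
--     Then (b a)·m = m for b # x, so m ≤ (b a)·x, i.e. m is a lower
--     bound of x⟨a⟩.  If m' is another lower bound, choose b fresh for
--     x and m'; then (b a)·m' ≤ x and a # (b a)·m', so (b a)·m' ≤ m and
--     m' ≤ (b a)·m = m.
-- (2) Let m = ⋀ x⟨a⟩.  For b ≠ a fresh for x the orbit is closed under
--     (b a), so (b a)·m = m; choosing b also fresh for m gives a # m.
--     If x' ≤ x and a # x', then substituting c for a (c # x) gives
--     x' = x'[a:=c] ≤ x[a:=c] = (c a)·x by monotonicity, so x' is a
--     lower bound of x⟨a⟩ and x' ≤ m.

open import Defs

open import Data.Nat using (suc; _≟_)
open import Data.Nat.Properties using (1+n≰n)
open import Data.List using (List; []; _∷_; _++_; map)
open import Data.List.Extrema.Nat using (max; xs≤max)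
open import Data.List.Relation.Unary.All as All using ()
open import Data.List.Relation.Unary.Any using (here; there)
open import Data.List.Membership.Propositional using (_∈_; _∉_)
open import Data.List.Membership.Propositional.Properties
  using (∈-map⁺; ∈-map⁻; ∈-++⁺ˡ; ∈-++⁺ʳ)
open import Data.Product using (∃; _×_; _,_)
open import Data.Sum using (inj₁; inj₂)
open import Function using (_∘_)
open import Relation.Nullary using (yes; no; contradiction)
open import Relation.Binary.PropositionalEquality
  using (_≡_; _≢_; refl; sym; trans; cong; cong₂; subst; subst₂; module ≡-Reasoning)
open import Relation.Binary.Structures using (IsPartialOrder)

swap-left : ∀ a b → swapA a b a ≡ b
swap-left a b with a ≟ a
... | yes _   = refl
... | no a≢a = contradiction refl a≢a

swap-right : ∀ a b → swapA a b b ≡ a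
swap-right a b with b ≟ a
... | yes b≡a = b≡a
... | no _ with b ≟ b
...   | yes _   = refl
...   | no b≢b = contradiction refl b≢b

swap-other : ∀ {a b c} → c ≢ a → c ≢ b → swapA a b c ≡ c
swap-other {a} {b} {c} c≢a c≢b with c ≟ a
... | yes c≡a = contradiction c≡a c≢a
... | no _ with c ≟ b
...   | yes c≡b = contradiction c≡b c≢b
...   | no _    = refl

atom-cases : (Q : Atom → Set) (a c : Atom) → Q a → (c ≢ a → Q c) → Q c
atom-cases Q a c Qa Qc with c ≟ a
... | yes refl = Qa
... | no c≢a  = Qc c≢a

swap-self : ∀ a c → swapA a a c ≡ c
swap-self a c = atom-cases (λ e → swapA a a e ≡ e) a c (swap-left a a)
  λ c≢a → swap-other c≢a c≢a

swap-involutive : ∀ a b c → swapA a b (swapA a b c) ≡ c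
swap-involutive a b c =
  atom-cases Q a c (trans (cong (swapA a b) (swap-left a b)) (swap-right a b)) λ c≢a →
  atom-cases Q b c (trans (cong (swapA a b) (swap-right a b)) (swap-left a b)) λ c≢b →
  trans (cong (swapA a b) (swap-other c≢a c≢b)) (swap-other c≢a c≢b)
  where Q = λ e → swapA a b (swapA a b e) ≡ e

swap-injective : ∀ p q {c d} → swapA p q c ≡ swapA p q d → c ≡ d
swap-injective p q {c} {d} e =
  trans (sym (swap-involutive p q c))
        (trans (cong (swapA p q) e) (swap-involutive p q d))

swap-equivariant : ∀ p q a b e →
  swapA p q (swapA a b e) ≡ swapA (swapA p q a) (swapA p q b) (swapA p q e)
swap-equivariant p q a b e =
  atom-cases Q a e (trans (cong (swapA p q) (swap-left a b))
                          (sym (swap-left (swapA p q a) (swapA p q b)))) λ e≢a →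
  atom-cases Q b e (trans (cong (swapA p q) (swap-right a b))
                          (sym (swap-right (swapA p q a) (swapA p q b)))) λ e≢b →
  trans (cong (swapA p q) (swap-other e≢a e≢b))
        (sym (swap-other (e≢a ∘ swap-injective p q) (e≢b ∘ swap-injective p q)))
  where Q = λ e → swapA p q (swapA a b e) ≡ swapA (swapA p q a) (swapA p q b) (swapA p q e)

swap-conjugate : ∀ p q a b e →
  swapA p q (swapA a b (swapA p q e)) ≡ swapA (swapA p q a) (swapA p q b) e
swap-conjugate p q a b e =
  trans (swap-equivariant p q a b (swapA p q e))
        (cong (swapA (swapA p q a) (swapA p q b)) (swap-involutive p q e))

-- (b c) = (c d)(b d)(c d) for b distinct from c and d; this lets a
-- swapping of two atoms be performed through a third, fresh one.
swap-through : ∀ b c d → b ≢ c → b ≢ d → ∀ e →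
  swapA b c e ≡ swapA c d (swapA b d (swapA c d e))
swap-through b c d b≢c b≢d e = sym (begin
  swapA c d (swapA b d (swapA c d e))
    ≡⟨ swap-conjugate c d b d e ⟩
  swapA (swapA c d b) (swapA c d d) e
    ≡⟨ cong₂ (λ u v → swapA u v e) (swap-other b≢c b≢d) (swap-right c d) ⟩
  swapA b c e
    ∎)
  where open ≡-Reasoning

swap-commute : ∀ a b c → b ≢ c → b ≢ a → ∀ e →
  swapA b a (swapA c a e) ≡ swapA c a (swapA b c e)
swap-commute a b c b≢c b≢a e = begin
  swapA b a (swapA c a e)
    ≡⟨ cong₂ (λ u v → swapA u v (swapA c a e)) (swap-other b≢c b≢a) (swap-left c a) ⟨
  swapA (swapA c a b) (swapA c a c) (swapA c a e)
    ≡⟨ swap-conjugate c a b c (swapA c a e) ⟨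
  swapA c a (swapA b c (swapA c a (swapA c a e)))
    ≡⟨ cong (swapA c a ∘ swapA b c) (swap-involutive c a e) ⟩
  swapA c a (swapA b c e)
    ∎
  where open ≡-Reasoning

inv : Perm → Perm
inv []      = []
inv (p ∷ π) = inv π ++ (p ∷ [])

permA-++ : ∀ π ρ c → permA (π ++ ρ) c ≡ permA π (permA ρ c)
permA-++ []            ρ c = refl
permA-++ ((a , b) ∷ π) ρ c = cong (swapA a b) (permA-++ π ρ c)

actWith-++ : ∀ {C : Set} (swp : Atom → Atom → C → C) π ρ x →
             actWith swp (π ++ ρ) x ≡ actWith swp π (actWith swp ρ x)
actWith-++ swp []            ρ x = refl
actWith-++ swp ((a , b) ∷ π) ρ x = cong (swp a b) (actWith-++ swp π ρ x)

permA-inv-l : ∀ π c → permA (inv π) (permA π c) ≡ c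
permA-inv-l []            c = refl
permA-inv-l ((a , b) ∷ π) c = begin
  permA (inv π ++ (a , b) ∷ []) (swapA a b (permA π c))   ≡⟨ permA-++ (inv π) _ _ ⟩
  permA (inv π) (swapA a b (swapA a b (permA π c)))       ≡⟨ cong (permA (inv π)) (swap-involutive a b _) ⟩
  permA (inv π) (permA π c)                               ≡⟨ permA-inv-l π c ⟩
  c                                                       ∎
  where open ≡-Reasoning

permA-inv-r : ∀ π c → permA π (permA (inv π) c) ≡ c
permA-inv-r []            c = refl
permA-inv-r ((a , b) ∷ π) c = begin
  swapA a b (permA π (permA (inv π ++ (a , b) ∷ []) c))   ≡⟨ cong (swapA a b ∘ permA π) (permA-++ (inv π) _ c) ⟩
  swapA a b (permA π (permA (inv π) (swapA a b c)))       ≡⟨ cong (swapA a b) (permA-inv-r π _) ⟩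
  swapA a b (swapA a b c)                                 ≡⟨ swap-involutive a b c ⟩
  c                                                       ∎
  where open ≡-Reasoning

-- The
-- definition is opaque since only the existence of the atom matters
-- (unfolding the witness max-plus-one during type checking is costly).
opaque
  fresh : (L : List Atom) → ∃ λ b → b ∉ L
  fresh L = suc (max 0 L) , λ b∈L → 1+n≰n (All.lookup (xs≤max 0 L) b∈L)

freshFor : (a : Atom) (S T : List Atom) → ∃ λ b → b ≢ a × b ∉ S × b ∉ T
freshFor a S T with fresh (a ∷ S ++ T)
... | b , b∉ = b , (b∉ ∘ here) , (b∉ ∘ there ∘ ∈-++⁺ˡ) , (b∉ ∘ there ∘ ∈-++⁺ʳ S)

module NominalFacts (X : NominalSet) where
  open NominalSet X

  act-inv-r : ∀ π y → act π (act (inv π) y) ≡ y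
  act-inv-r π y =
    trans (sym (actWith-++ swp π (inv π) y))
          (act-ext (π ++ inv π) [] (λ c → trans (permA-++ π (inv π) c) (permA-inv-r π c)) y)

  act-inv-l : ∀ π y → act (inv π) (act π y) ≡ y
  act-inv-l π y =
    trans (sym (actWith-++ swp (inv π) π y))
          (act-ext (inv π ++ π) [] (λ c → trans (permA-++ (inv π) π c) (permA-inv-l π c)) y)

  swap-self-act : ∀ c y → swp c c y ≡ y
  swap-self-act c y = act-ext ((c , c) ∷ []) [] (swap-self c) y

  swap-involutive-act : ∀ b a y → swp b a (swp b a y) ≡ y
  swap-involutive-act b a y = act-ext ((b , a) ∷ (b , a) ∷ []) [] (swap-involutive b a) y

  -- If S supports y then π·S supports π·y: for ρ fixing π·S, the
  -- conjugate π⁻¹ρπ fixes S and hence y.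
  supports-equivariant : ∀ π {S y} → Supports S y → Supports (map (permA π) S) (act π y)
  supports-equivariant π {S} {y} S-supp ρ ρ-fix = begin
    act ρ (act π y)                                  ≡⟨ act-inv-r π _ ⟨
    act π (act (inv π) (act ρ (act π y)))            ≡⟨ cong (act π) conjugate-fixes ⟩
    act π y                                          ∎
    where
    open ≡-Reasoning
    conjugate-fixes : act (inv π) (act ρ (act π y)) ≡ y
    conjugate-fixes = begin
      act (inv π) (act ρ (act π y))    ≡⟨ cong (act (inv π)) (actWith-++ swp ρ π y) ⟨
      act (inv π) (act (ρ ++ π) y)     ≡⟨ actWith-++ swp (inv π) (ρ ++ π) y ⟨
      act (inv π ++ ρ ++ π) y          ≡⟨ S-supp (inv π ++ ρ ++ π) (λ s s∈S → begin
          permA (inv π ++ ρ ++ π) s        ≡⟨ permA-++ (inv π) (ρ ++ π) s ⟩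
          permA (inv π) (permA (ρ ++ π) s) ≡⟨ cong (permA (inv π)) (permA-++ ρ π s) ⟩
          permA (inv π) (permA ρ (permA π s))
                                           ≡⟨ cong (permA (inv π)) (ρ-fix _ (∈-map⁺ (permA π) s∈S)) ⟩
          permA (inv π) (permA π s)        ≡⟨ permA-inv-l π s ⟩
          s                                ∎) ⟩
      y                                ∎

  #-equivariant : ∀ π {a y} → a # y → permA π a # act π y
  #-equivariant π {a} (S , S-supp , a∉S) =
    map (permA π) S , supports-equivariant π S-supp , πa∉πS
    where
    πa∉πS : permA π a ∉ map (permA π) S
    πa∉πS πa∈πS with ∈-map⁻ (permA π) πa∈πS
    ... | s , s∈S , πa≡πs =
      a∉S (subst (_∈ S) (trans (sym (permA-inv-l π s))
                              (trans (cong (permA (inv π)) (sym πa≡πs)) (permA-inv-l π a))) s∈S)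

  swap-outside-support : ∀ {p q S y} → Supports S y → p ∉ S → q ∉ S → swp p q y ≡ y
  swap-outside-support {p} {q} S-supp p∉S q∉S = S-supp ((p , q) ∷ [])
    (λ s s∈S → swap-other (λ s≡p → p∉S (subst (_∈ _) s≡p s∈S))
                          (λ s≡q → q∉S (subst (_∈ _) s≡q s∈S)))

  -- Swapping two atoms fresh for y fixes y.  The two atoms may be
  -- outside different supports, so the swapping is routed through an
  -- atom d outside both (swap-through).
  swap-fresh : ∀ {b c y} → b # y → c # y → swp b c y ≡ y
  swap-fresh {b} {c} {y} (Sb , Sb-supp , b∉Sb) (Sc , Sc-supp , c∉Sc) with b ≟ c
  ... | yes refl = swap-self-act b y
  ... | no b≢c with freshFor b (c ∷ Sb) Sc
  ...   | d , d≢b , d∉cSb , d∉Sc = begin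
    swp b c y                        ≡⟨ act-ext ((b , c) ∷ []) ((c , d) ∷ (b , d) ∷ (c , d) ∷ [])
                                          (swap-through b c d b≢c (d≢b ∘ sym)) y ⟩
    swp c d (swp b d (swp c d y))    ≡⟨ cong (swp c d ∘ swp b d) c-d-fixes ⟩
    swp c d (swp b d y)              ≡⟨ cong (swp c d) (swap-outside-support Sb-supp b∉Sb (d∉cSb ∘ there)) ⟩
    swp c d y                        ≡⟨ c-d-fixes ⟩
    y                                ∎
    where
    open ≡-Reasoning
    c-d-fixes : swp c d y ≡ y
    c-d-fixes = swap-outside-support Sc-supp c∉Sc d∉Sc

  #-swap : ∀ {a b y} → b # y → a # swp b a y
  #-swap {a} {b} {y} b#y = subst (_# swp b a y) (swap-left b a) (#-equivariant ((b , a) ∷ []) b#y)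

  fresh-by-swap : ∀ {a b y} → b # y → swp b a y ≡ y → a # y
  fresh-by-swap {a} b#y fixed = subst (a #_) fixed (#-swap b#y)

module PosetFacts (X : NominalSet) (P : NominalPosetStr X) where
  open NominalSet X
  open NominalPosetStr P
  open IsPartialOrder isPartialOrder using (antisym)
  open NominalFacts X

  ≤-swapˡ : ∀ {b a u v} → u ≤ swp b a v → swp b a u ≤ v
  ≤-swapˡ {b} {a} {u} {v} u≤v' =
    subst (swp b a u ≤_) (swap-involutive-act b a v) (≤-equivariant ((b , a) ∷ []) u≤v')

  ≤-swapʳ : ∀ {b a u v} → swp b a u ≤ v → u ≤ swp b a v
  ≤-swapʳ {b} {a} {u} {v} u'≤v =
    subst (_≤ swp b a v) (swap-involutive-act b a u) (≤-equivariant ((b , a) ∷ []) u'≤v)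

  freshMeet-unique : ∀ {a x m m'} → IsFreshMeet X P a x m → IsFreshMeet X P a x m' → m ≡ m'
  freshMeet-unique (m≤x , a#m , m-greatest) (m'≤x , a#m' , m'-greatest) =
    antisym (m'-greatest _ m≤x a#m) (m-greatest _ m'≤x a#m')

  freshMeet-equivariant : ∀ π {a x m} → IsFreshMeet X P a x m →
    IsFreshMeet X P (permA π a) (act π x) (act π m)
  freshMeet-equivariant π {a} {x} {m} (m≤x , a#m , greatest) =
    ≤-equivariant π m≤x , #-equivariant π a#m , greatest'
    where
    greatest' : ∀ x' → x' ≤ act π x → permA π a # x' → x' ≤ act π m
    greatest' x' x'≤πx πa#x' = subst (_≤ act π m) (act-inv-r π x')
      (≤-equivariant π (greatest (act (inv π) x')
        (subst (act (inv π) x' ≤_) (act-inv-l π x) (≤-equivariant (inv π) x'≤πx))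
        (subst (_# act (inv π) x') (permA-inv-l π a) (#-equivariant (inv π) πa#x'))))

  -- supp(⋀^{#a} x) ⊆ {a} ∪ supp(x): a permutation fixing a and a support
  -- of x maps m to a fresh meet of a and x, which is m itself.
  freshMeet-support : ∀ {a x m Sx} → IsFreshMeet X P a x m → Supports Sx x →
    Supports (a ∷ Sx) m
  freshMeet-support {a} {m = m} fm Sx-supp π π-fix =
    freshMeet-unique (subst₂ (λ a' x' → IsFreshMeet X P a' x' (act π m))
                             (π-fix a (here refl)) (Sx-supp π (λ s → π-fix s ∘ there))
                             (freshMeet-equivariant π fm))
                     fm

  freshMeet-fresh : ∀ {a x m b} → IsFreshMeet X P a x m → b # x → b # m
  freshMeet-fresh {a} {b = b} fm (Sx , Sx-supp , b∉Sx) with b ≟ a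
  ... | yes refl = let (_ , a#m , _) = fm in a#m
  ... | no b≢a  = a ∷ Sx , freshMeet-support fm Sx-supp ,
                  λ { (here b≡a) → b≢a b≡a ; (there b∈Sx) → b∉Sx b∈Sx }

  glb-swap-invariant : ∀ {A b a m} → (∀ y → A y → A (swp b a y)) →
    IsGLB X P A m → swp b a m ≡ m
  glb-swap-invariant closed (lower , greatest) = antisym swapped≤m (≤-swapʳ swapped≤m)
    where
    swapped≤m = greatest _ (λ y Ay → ≤-swapˡ (lower _ (closed y Ay)))

  orbit-swap-closed : ∀ {a x b} → b ≢ a → b # x →
    ∀ y → Orbit X P a x y → Orbit X P a x (swp b a y)
  orbit-swap-closed b≢a b#x y (inj₁ refl) = inj₂ (_ , b#x , refl)
  orbit-swap-closed {a} {x} {b} b≢a b#x y (inj₂ (c , c#x , refl)) with c ≟ b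
  ... | yes refl = inj₁ (swap-involutive-act c a x)
  ... | no c≢b  = inj₂ (c , c#x , (begin
    swp b a (swp c a x)    ≡⟨ act-ext ((b , a) ∷ (c , a) ∷ []) ((c , a) ∷ (b , c) ∷ [])
                                (swap-commute a b c (c≢b ∘ sym) b≢a) x ⟩
    swp c a (swp b c x)    ≡⟨ cong (swp c a) (swap-fresh b#x c#x) ⟩
    swp c a x              ∎))
    where open ≡-Reasoning

module FreshMeetIsGLB (X : NominalSet) (P : NominalPosetStr X) where
  open NominalSet X
  open NominalPosetStr P
  open NominalFacts X
  open PosetFacts X P

  freshMeet⇒glb : ∀ {a x m} → IsFreshMeet X P a x m → IsGLB X P (Orbit X P a x) m
  freshMeet⇒glb {a} {x} {m} fm@(m≤x , a#m , greatest) = lower , greatest-lower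
    where
    fixed-by : ∀ {b} → b # x → swp b a m ≡ m
    fixed-by b#x = swap-fresh (freshMeet-fresh fm b#x) a#m

    lower : ∀ y → Orbit X P a x y → m ≤ y
    lower y (inj₁ refl)              = m≤x
    lower y (inj₂ (b , b#x , refl)) = subst (_≤ y) (fixed-by b#x) (≤-equivariant ((b , a) ∷ []) m≤x)

    greatest-lower : ∀ m' → (∀ y → Orbit X P a x y → m' ≤ y) → m' ≤ m
    greatest-lower m' m'-lower with finsupp x | finsupp m'
    ... | Sx , Sx-supp | Sm' , Sm'-supp with freshFor a Sx Sm'
    ...   | b , _ , b∉Sx , b∉Sm' =
      subst (m' ≤_) (fixed-by b#x) (≤-swapʳ (greatest _ swapped≤x a#swapped))
      where
      b#x : b # x
      b#x = Sx , Sx-supp , b∉Sx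
      swapped≤x : swp b a m' ≤ x
      swapped≤x = ≤-swapˡ (m'-lower _ (inj₂ (b , b#x , refl)))
      a#swapped : a # swp b a m'
      a#swapped = #-swap (Sm' , Sm'-supp , b∉Sm')

module SigmaFacts (𝕌 : Termlike) (X : NominalSet) (S : SigmaAlgebra 𝕌 X) where
  open NominalSet X
  open SigmaAlgebra S

  rename-by-sub : ∀ {a c x} → c ≢ a → c # x → sub x a (Termlike.atm 𝕌 c) ≡ swp c a x
  rename-by-sub {a} {c} {x} c≢a c#x =
    trans (α a c x (Termlike.atm 𝕌 c) (c≢a ∘ sym) c#x) (id↦ c (swp c a x))

module GLBIsFreshMeet (𝕌 : Termlike) (X : NominalSet) (P : NominalPosetStr X)
                      (S : SigmaAlgebra 𝕌 X) (mono : Monotone P S) where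
  open NominalSet X
  open NominalPosetStr P
  open SigmaAlgebra S using (#↦)
  open NominalFacts X
  open PosetFacts X P
  open SigmaFacts 𝕌 X S

  -- Every x' ≤ x with a # x' is a lower bound of x⟨a⟩:
  -- x' = x'[a:=c] ≤ x[a:=c] = (c a)·x.
  fresh-below-lower : ∀ {a x x'} → x' ≤ x → a # x' → ∀ y → Orbit X P a x y → x' ≤ y
  fresh-below-lower x'≤x a#x' y (inj₁ refl) = x'≤x
  fresh-below-lower {a} {x} {x'} x'≤x a#x' y (inj₂ (c , c#x , refl)) with c ≟ a
  ... | yes refl = subst (x' ≤_) (sym (swap-self-act c x)) x'≤x
  ... | no c≢a  = subst₂ _≤_ (#↦ a x' (Termlike.atm 𝕌 c) a#x') (rename-by-sub c≢a c#x)
                              (mono a (Termlike.atm 𝕌 c) x'≤x)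

  glb⇒freshMeet : ∀ {a x m} → IsGLB X P (Orbit X P a x) m → IsFreshMeet X P a x m
  glb⇒freshMeet {a} {x} {m} glb@(lower , greatest) =
    lower x (inj₁ refl) , a#m ,
    λ x' x'≤x a#x' → greatest x' (fresh-below-lower x'≤x a#x')
    where
    a#m : a # m
    a#m with finsupp x | finsupp m
    ... | Sx , Sx-supp | Sm , Sm-supp with freshFor a Sx Sm
    ...   | b , b≢a , b∉Sx , b∉Sm =
      fresh-by-swap (Sm , Sm-supp , b∉Sm)
                    (glb-swap-invariant (orbit-swap-closed b≢a (Sx , Sx-supp , b∉Sx)) glb)

proposition8p17 :
    (∀ (X : NominalSet) (P : NominalPosetStr X) a x m →
        IsFreshMeet X P a x m → IsGLB X P (Orbit X P a x) m)
    ×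
    (∀ (𝕌 : Termlike) (X : NominalSet) (P : NominalPosetStr X)
        (S : SigmaAlgebra 𝕌 X) → Monotone P S →
        ∀ a x m → IsGLB X P (Orbit X P a x) m → IsFreshMeet X P a x m)
proposition8p17 =
  (λ X P a x m → FreshMeetIsGLB.freshMeet⇒glb X P)
  , (λ 𝕌 X P S mono a x m → GLBIsFreshMeet.glb⇒freshMeet 𝕌 X P S mono)
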